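{- Let $F(x,y)=\sum_{i=0}^na_ix^{n-i}y^i$ be an irreducible binary form with integer coefficients, let $l\in\mathbb{Z}$, and write $F(x+ly,y)=\sum_{i=0}^nb_ix^{n-i}y^i$. For $i\ge1$ define the polynomials $s_i(x)=\sum_{j=0}^{i-1}a_jx^{i-j}$ and $m_i(x)=\sum_{j=0}^{i-1}b_jx^{i-j}$. Then for every $1\le k\le n-1$, as an identity of polynomials in $x$, $$m_k(x-l)+b_k=\sum_{j=0}^{k-1}\binom{n-k+j-1}{j}\bigl(s_{k-j}(x)+a_{k-j}\bigr)l^j+\binom{n-1}{k}l^ka_0.$$ -}

module Defs where

open import Data.Nat as ℕ using (ℕ; zero; suc; _∸_)
open import Data.Integer using (ℤ; _+_; _*_; _^_; 0ℤ)
open import Data.Product using (Σ; _×_; ∃)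
open import Relation.Binary.PropositionalEquality using (_≡_)
open import Relation.Nullary using (¬_)

sumBelow : ℕ → (ℕ → ℤ) → ℤ
sumBelow zero    f = 0ℤ
sumBelow (suc n) f = sumBelow n f + f n

-- A binary form of degree n with coefficient sequence a (only a 0 .. a n matter):
-- evalForm n a x y = Σ_{i=0}^{n} a_i x^{n-i} y^i
evalForm : ℕ → (ℕ → ℤ) → ℤ → ℤ → ℤ
evalForm n a x y = sumBelow (suc n) (λ i → a i * (x ^ (n ∸ i)) * (y ^ i))

ZeroForm : ℕ → (ℕ → ℤ) → Set
ZeroForm n a = ∀ i → i ℕ.≤ n → a i ≡ 0ℤ

-- Irreducible (over ℚ, equivalently by Gauss's lemma: no factorisation into two
-- integral binary forms of positive degree).  Polynomial equality in ℤ[x,y] is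
-- expressed as equality of the evaluation functions on ℤ × ℤ (ℤ infinite domain).
IrreducibleForm : ℕ → (ℕ → ℤ) → Set
IrreducibleForm n a =
  (1 ℕ.≤ n) × (¬ ZeroForm n a) ×
  (¬ (Σ ℕ λ p → Σ ℕ λ q → Σ (ℕ → ℤ) λ g → Σ (ℕ → ℤ) λ h →
        (1 ℕ.≤ p) × (1 ℕ.≤ q) × (p ℕ.+ q ≡ n) ×
        (∀ x y → evalForm n a x y ≡ evalForm p g x y * evalForm q h x y)))

-- s_i(x) = Σ_{j=0}^{i-1} c_j x^{i-j}  (used for both s (c = a) and m (c = b))
sPoly : (ℕ → ℤ) → ℕ → ℤ → ℤ
sPoly c i x = sumBelow i (λ j → c j * (x ^ (i ∸ j)))

-- Setting y = 1, the hypothesis says Σ b_i z^(n-i) = Σ a_i (z + l)^(n-i) for every integer z, so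
-- b_j = Σ_{i ≤ j} a_i C(n-i, j-i) l^(j-i).  Both sides of the identity are truncated Horner sums
-- Σ_{i ≤ k} c_i z^(k-i); with these b_j the left side becomes a convolution
-- Σ_{i ≤ k} a_i Σ_{t ≤ k-i} C(n-i, t) l^t (x - l)^(k-i-t), and Pascal's rule turns each inner truncated
-- binomial expansion at x - l into Σ_{t ≤ k-i} C(n-k-1+t, t) l^t x^(k-i-t).  Exchanging the order of
-- summation of the resulting convolution gives the right side.
module Submission where

open import Defs
open import Data.Nat as ℕ using (ℕ; zero; suc; _∸_; z≤n; s≤s)
import Data.Nat.Properties as ℕP
open import Data.Nat.Combinatorics using (_C_; nCk+nC[k+1]≡[n+1]C[k+1]; k>n⇒nCk≡0)
open import Data.Nat.Divisibility using (_∣_; m∣m*n; >⇒∤)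
open import Data.Integer using (ℤ; _+_; _-_; _*_; _^_; +_; -_; 0ℤ; 1ℤ; ∣_∣)
import Data.Integer.Properties as ℤP
open import Data.Integer.Tactic.RingSolver using (solve-∀)
open import Algebra.Properties.AbelianGroup ℤP.+-0-abelianGroup using (inverseʳ-unique)
open import Algebra.Properties.CommutativeSemigroup ℤP.*-commutativeSemigroup using (xy∙z≈xz∙y)
open import Data.Sum using (inj₁; inj₂)
open import Relation.Nullary using (¬_; contradiction)
open import Relation.Binary.PropositionalEquality
  using (_≡_; refl; sym; trans; cong; cong₂; subst; module ≡-Reasoning)
open ≡-Reasoning

sumBelow-cong : ∀ m {f g : ℕ → ℤ} → (∀ i → i ℕ.< m → f i ≡ g i) → sumBelow m f ≡ sumBelow m g
sumBelow-cong zero    f≗g = refl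
sumBelow-cong (suc m) f≗g =
  cong₂ _+_ (sumBelow-cong m (λ i i<m → f≗g i (ℕP.m<n⇒m<1+n i<m))) (f≗g m ℕP.≤-refl)

sumBelow-+ : ∀ m (f g : ℕ → ℤ) → sumBelow m (λ i → f i + g i) ≡ sumBelow m f + sumBelow m g
sumBelow-+ zero    f g = refl
sumBelow-+ (suc m) f g = begin
  sumBelow m (λ i → f i + g i) + (f m + g m)   ≡⟨ cong (_+ (f m + g m)) (sumBelow-+ m f g) ⟩
  (sumBelow m f + sumBelow m g) + (f m + g m)  ≡⟨ interchange (sumBelow m f) (sumBelow m g) (f m) (g m) ⟩
  (sumBelow m f + f m) + (sumBelow m g + g m)  ∎
  where
  interchange : ∀ (a b c d : ℤ) → (a + b) + (c + d) ≡ (a + c) + (b + d)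
  interchange = solve-∀

sumBelow-*ˡ : ∀ m (c : ℤ) (f : ℕ → ℤ) → sumBelow m (λ i → c * f i) ≡ c * sumBelow m f
sumBelow-*ˡ zero    c f = sym (ℤP.*-zeroʳ c)
sumBelow-*ˡ (suc m) c f =
  trans (cong (_+ c * f m) (sumBelow-*ˡ m c f)) (sym (ℤP.*-distribˡ-+ c (sumBelow m f) (f m)))

sumBelow-head : ∀ m (f : ℕ → ℤ) → sumBelow (suc m) f ≡ f 0 + sumBelow m (λ i → f (suc i))
sumBelow-head zero    f = trans (ℤP.+-identityˡ (f 0)) (sym (ℤP.+-identityʳ (f 0)))
sumBelow-head (suc m) f = trans (cong (_+ f (suc m)) (sumBelow-head m f)) (ℤP.+-assoc (f 0) _ _)

sumBelow-reverse : ∀ m (f : ℕ → ℤ) → sumBelow m f ≡ sumBelow m (λ i → f (m ∸ suc i))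
sumBelow-reverse zero    f = refl
sumBelow-reverse (suc m) f = begin
  sumBelow m f + f m                        ≡⟨ ℤP.+-comm _ (f m) ⟩
  f m + sumBelow m f                        ≡⟨ cong (_+_ (f m)) (sumBelow-reverse m f) ⟩
  f m + sumBelow m (λ i → f (m ∸ suc i))    ≡⟨ sumBelow-head m (λ i → f (m ∸ i)) ⟨
  sumBelow (suc m) (λ i → f (m ∸ i))        ∎

-- The paper's s_m(z) + c_m, that is Σ_{i ≤ m} c_i z^(m-i).
horner : (ℕ → ℤ) → ℕ → ℤ → ℤ
horner c m z = sPoly c m z + c m

horner-zero : ∀ c z → horner c 0 z ≡ c 0
horner-zero c z = ℤP.+-identityˡ (c 0)

horner-sumBelow : ∀ c m z → horner c m z ≡ sumBelow (suc m) (λ i → c i * z ^ (m ∸ i))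
horner-sumBelow c m z = cong (_+_ (sPoly c m z)) (sym (begin
  c m * z ^ (m ∸ m)  ≡⟨ cong (λ e → c m * z ^ e) (ℕP.n∸n≡0 m) ⟩
  c m * 1ℤ           ≡⟨ ℤP.*-identityʳ (c m) ⟩
  c m                ∎))

sPoly-suc : ∀ c m z → sPoly c (suc m) z ≡ z * horner c m z
sPoly-suc c m z = begin
  sumBelow (suc m) (λ j → c j * z ^ (suc m ∸ j))
    ≡⟨ sumBelow-cong (suc m) (λ j j<1+m → trans
         (cong (λ e → c j * z ^ e) (ℕP.+-∸-assoc 1 (ℕP.≤-pred j<1+m)))
         (swap (c j) z (z ^ (m ∸ j)))) ⟩
  sumBelow (suc m) (λ j → z * (c j * z ^ (m ∸ j)))  ≡⟨ sumBelow-*ˡ (suc m) z _ ⟩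
  z * sumBelow (suc m) (λ j → c j * z ^ (m ∸ j))    ≡⟨ cong (z *_) (horner-sumBelow c m z) ⟨
  z * horner c m z                                  ∎
  where
  swap : ∀ (a z w : ℤ) → a * (z * w) ≡ z * (a * w)
  swap = solve-∀

horner-suc : ∀ c m z → horner c (suc m) z ≡ z * horner c m z + c (suc m)
horner-suc c m z = cong (_+ c (suc m)) (sPoly-suc c m z)

horner-step : ∀ c {s t} z → s ≡ suc t → horner c s z ≡ z * horner c t z + c s
horner-step c z refl = horner-suc c _ z

horner-cong : ∀ m z {f g : ℕ → ℤ} → (∀ j → j ℕ.≤ m → f j ≡ g j) → horner f m z ≡ horner g m z
horner-cong m z {f} {g} f≗g = begin
  horner f m z                                    ≡⟨ horner-sumBelow f m z ⟩
  sumBelow (suc m) (λ i → f i * z ^ (m ∸ i))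
    ≡⟨ sumBelow-cong (suc m) (λ i i≤m → cong (_* z ^ (m ∸ i)) (f≗g i (ℕP.≤-pred i≤m))) ⟩
  sumBelow (suc m) (λ i → g i * z ^ (m ∸ i))      ≡⟨ horner-sumBelow g m z ⟨
  horner g m z                                    ∎

horner-- : ∀ f g m z → horner (λ j → f j - g j) m z ≡ horner f m z - horner g m z
horner-- f g zero    z = begin
  horner (λ j → f j - g j) 0 z  ≡⟨ horner-zero (λ j → f j - g j) z ⟩
  f 0 - g 0                     ≡⟨ cong₂ _-_ (horner-zero f z) (horner-zero g z) ⟨
  horner f 0 z - horner g 0 z   ∎
horner-- f g (suc m) z = begin
  horner (λ j → f j - g j) (suc m) z
    ≡⟨ horner-suc (λ j → f j - g j) m z ⟩
  z * horner (λ j → f j - g j) m z + (f (suc m) - g (suc m))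
    ≡⟨ cong (λ t → z * t + (f (suc m) - g (suc m))) (horner-- f g m z) ⟩
  z * (horner f m z - horner g m z) + (f (suc m) - g (suc m))
    ≡⟨ distrib z (horner f m z) (horner g m z) (f (suc m)) (g (suc m)) ⟩
  (z * horner f m z + f (suc m)) - (z * horner g m z + g (suc m))
    ≡⟨ cong₂ _-_ (horner-suc f m z) (horner-suc g m z) ⟨
  horner f (suc m) z - horner g (suc m) z ∎
  where
  distrib : ∀ (z a b c d : ℤ) → z * (a - b) + (c - d) ≡ (z * a + c) - (z * b + d)
  distrib = solve-∀

evalForm-at-1 : ∀ n c x → evalForm n c x 1ℤ ≡ horner c n x
evalForm-at-1 n c x = begin
  evalForm n c x 1ℤ
    ≡⟨ sumBelow-cong (suc n) (λ i _ →
         trans (cong (c i * x ^ (n ∸ i) *_) (ℤP.^-zeroˡ i)) (ℤP.*-identityʳ _)) ⟩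
  sumBelow (suc n) (λ i → c i * x ^ (n ∸ i))   ≡⟨ horner-sumBelow c n x ⟨
  horner c n x                                 ∎

1+n∣n⇒n≡0 : ∀ n → suc n ∣ n → n ≡ 0
1+n∣n⇒n≡0 zero    _       = refl
1+n∣n⇒n≡0 (suc n) 2+n∣1+n = contradiction 2+n∣1+n (>⇒∤ (ℕP.n<1+n (suc n)))

[1+∣c∣]*t+c≡0⇒c≡0 : ∀ t c → + suc ∣ c ∣ * t + c ≡ 0ℤ → c ≡ 0ℤ
[1+∣c∣]*t+c≡0⇒c≡0 t c eq = ℤP.∣i∣≡0⇒i≡0 (1+n∣n⇒n≡0 ∣ c ∣ (subst (suc ∣ c ∣ ∣_) (sym ∣c∣≡) (m∣m*n ∣ t ∣)))
  where
  ∣c∣≡ : ∣ c ∣ ≡ suc ∣ c ∣ ℕ.* ∣ t ∣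
  ∣c∣≡ = begin
    ∣ c ∣                      ≡⟨ cong ∣_∣ (inverseʳ-unique (+ suc ∣ c ∣ * t) c eq) ⟩
    ∣ - (+ suc ∣ c ∣ * t) ∣    ≡⟨ ℤP.∣-i∣≡∣i∣ (+ suc ∣ c ∣ * t) ⟩
    ∣ + suc ∣ c ∣ * t ∣        ≡⟨ ℤP.abs-* (+ suc ∣ c ∣) t ⟩
    suc ∣ c ∣ ℕ.* ∣ t ∣        ∎

-- Evaluating at z = 1 + ∣c (suc m)∣ makes the constant term a multiple of something larger than itself.
horner≡0⇒last≡0 : ∀ m c → (∀ z → ¬ z ≡ 0ℤ → horner c (suc m) z ≡ 0ℤ) → c (suc m) ≡ 0ℤ
horner≡0⇒last≡0 m c vanish =
  [1+∣c∣]*t+c≡0⇒c≡0 (horner c m z) (c (suc m)) (trans (sym (horner-suc c m z)) (vanish z (λ ())))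
  where
  z = + suc ∣ c (suc m) ∣

horner≡0⇒coefficients≡0 : ∀ m c → (∀ z → ¬ z ≡ 0ℤ → horner c m z ≡ 0ℤ) → ∀ j → j ℕ.≤ m → c j ≡ 0ℤ
horner≡0⇒coefficients≡0 zero    c vanish .0 z≤n = trans (sym (horner-zero c 1ℤ)) (vanish 1ℤ (λ ()))
horner≡0⇒coefficients≡0 (suc m) c vanish j j≤1+m with ℕP.m≤n⇒m<n∨m≡n j≤1+m
... | inj₂ refl    = horner≡0⇒last≡0 m c vanish
... | inj₁ j<1+m = horner≡0⇒coefficients≡0 m c vanish′ j (ℕP.≤-pred j<1+m)
  where
  z*horner≡0 : ∀ z → ¬ z ≡ 0ℤ → z * horner c m z ≡ 0ℤ
  z*horner≡0 z z≢0 = begin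
    z * horner c m z                ≡⟨ ℤP.+-identityʳ _ ⟨
    z * horner c m z + 0ℤ           ≡⟨ cong (_+_ (z * horner c m z)) (horner≡0⇒last≡0 m c vanish) ⟨
    z * horner c m z + c (suc m)    ≡⟨ horner-suc c m z ⟨
    horner c (suc m) z              ≡⟨ vanish z z≢0 ⟩
    0ℤ                              ∎
  vanish′ : ∀ z → ¬ z ≡ 0ℤ → horner c m z ≡ 0ℤ
  vanish′ z z≢0 with ℤP.i*j≡0⇒i≡0∨j≡0 z (z*horner≡0 z z≢0)
  ... | inj₁ z≡0 = contradiction z≡0 z≢0
  ... | inj₂ h≡0 = h≡0

horner-injective : ∀ m f g → (∀ z → horner f m z ≡ horner g m z) → ∀ j → j ℕ.≤ m → f j ≡ g j
horner-injective m f g f≡g j j≤m =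
  ℤP.i-j≡0⇒i≡j (f j) (g j) (horner≡0⇒coefficients≡0 m (λ i → f i - g i) vanish j j≤m)
  where
  vanish : ∀ z → ¬ z ≡ 0ℤ → horner (λ i → f i - g i) m z ≡ 0ℤ
  vanish z _ = begin
    horner (λ i → f i - g i) m z   ≡⟨ horner-- f g m z ⟩
    horner f m z - horner g m z    ≡⟨ cong (_- horner g m z) (f≡g z) ⟩
    horner g m z - horner g m z    ≡⟨ ℤP.+-inverseʳ (horner g m z) ⟩
    0ℤ                             ∎

horner-convolution : ∀ (a : ℕ → ℤ) (d : ℕ → ℕ → ℤ) k y →
  horner (λ j → sumBelow (suc j) (λ i → a i * d i (j ∸ i))) k y
  ≡ sumBelow (suc k) (λ i → a i * horner (d i) (k ∸ i) y)
horner-convolution a d zero    y =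
  trans (horner-zero (λ j → sumBelow (suc j) (λ i → a i * d i (j ∸ i))) y) (cong (λ t → 0ℤ + a 0 * t) (sym (horner-zero (d 0) y)))
horner-convolution a d (suc k) y = begin
  horner c (suc k) y                                           ≡⟨ horner-suc c k y ⟩
  y * horner c k y + (sumBelow (suc k) g + g (suc k))
    ≡⟨ cong (λ t → y * t + (sumBelow (suc k) g + g (suc k))) (horner-convolution a d k y) ⟩
  y * sumBelow (suc k) h + (sumBelow (suc k) g + g (suc k))    ≡⟨ ℤP.+-assoc (y * sumBelow (suc k) h) _ _ ⟨
  (y * sumBelow (suc k) h + sumBelow (suc k) g) + g (suc k)
    ≡⟨ cong (λ s → (s + sumBelow (suc k) g) + g (suc k)) (sumBelow-*ˡ (suc k) y h) ⟨
  (sumBelow (suc k) (λ i → y * h i) + sumBelow (suc k) g) + g (suc k)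
    ≡⟨ cong (_+ g (suc k)) (sumBelow-+ (suc k) (λ i → y * h i) g) ⟨
  sumBelow (suc k) (λ i → y * h i + g i) + g (suc k)
    ≡⟨ cong₂ _+_ (sumBelow-cong (suc k) (λ i i≤k → step i (ℕP.≤-pred i≤k))) (cong (a (suc k) *_) lastTerm) ⟩
  sumBelow (suc k) (λ i → a i * horner (d i) (suc k ∸ i) y) + a (suc k) * horner (d (suc k)) (k ∸ k) y ∎
  where
  c g h : ℕ → ℤ
  c j = sumBelow (suc j) (λ i → a i * d i (j ∸ i))
  g i = a i * d i (suc k ∸ i)
  h i = a i * horner (d i) (k ∸ i) y
  distrib : ∀ (y a u v : ℤ) → y * (a * u) + a * v ≡ a * (y * u + v)
  distrib = solve-∀
  step : ∀ i → i ℕ.≤ k → y * h i + g i ≡ a i * horner (d i) (suc k ∸ i) y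
  step i i≤k = trans (distrib y (a i) (horner (d i) (k ∸ i) y) (d i (suc k ∸ i)))
                     (cong (a i *_) (sym (horner-step (d i) y (ℕP.+-∸-assoc 1 i≤k))))
  lastTerm : d (suc k) (k ∸ k) ≡ horner (d (suc k)) (k ∸ k) y
  lastTerm rewrite ℕP.n∸n≡0 k = sym (horner-zero (d (suc k)) y)

convolution-comm : ∀ (a e : ℕ → ℤ) j →
  sumBelow (suc j) (λ i → a i * e (j ∸ i)) ≡ sumBelow (suc j) (λ i → e i * a (j ∸ i))
convolution-comm a e j = trans (sumBelow-reverse (suc j) (λ i → a i * e (j ∸ i)))
  (sumBelow-cong (suc j) (λ i i<1+j → begin
    a (j ∸ i) * e (j ∸ (j ∸ i))   ≡⟨ cong (λ t → a (j ∸ i) * e t) (ℕP.m∸[m∸n]≡n (ℕP.≤-pred i<1+j)) ⟩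
    a (j ∸ i) * e i               ≡⟨ ℤP.*-comm (a (j ∸ i)) (e i) ⟩
    e i * a (j ∸ i)               ∎))

-- Both sides are horner of the Cauchy product of a and e, in its two orders.
sumBelow-horner-swap : ∀ (a e : ℕ → ℤ) k x →
  sumBelow (suc k) (λ i → a i * horner e (k ∸ i) x) ≡ sumBelow (suc k) (λ j → e j * horner a (k ∸ j) x)
sumBelow-horner-swap a e k x = begin
  sumBelow (suc k) (λ i → a i * horner e (k ∸ i) x)
    ≡⟨ horner-convolution a (λ _ → e) k x ⟨
  horner (λ j → sumBelow (suc j) (λ i → a i * e (j ∸ i))) k x
    ≡⟨ horner-cong k x (λ j _ → convolution-comm a e j) ⟩
  horner (λ j → sumBelow (suc j) (λ i → e i * a (j ∸ i))) k x
    ≡⟨ horner-convolution e (λ _ → a) k x ⟩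
  sumBelow (suc k) (λ j → e j * horner a (k ∸ j) x) ∎

binomialTerms : ℕ → ℤ → ℕ → ℤ
binomialTerms M l t = + (M C t) * l ^ t

binomialTerms-pascal : ∀ M l t →
  binomialTerms (suc M) l (suc t) ≡ l * binomialTerms M l t + binomialTerms M l (suc t)
binomialTerms-pascal M l t = begin
  + (suc M C suc t) * (l * l ^ t)
    ≡⟨ cong (λ m → + m * (l * l ^ t)) (nCk+nC[k+1]≡[n+1]C[k+1] M t) ⟨
  + (M C t ℕ.+ M C suc t) * (l * l ^ t)
    ≡⟨ cong (_* (l * l ^ t)) (ℤP.pos-+ (M C t) (M C suc t)) ⟩
  (+ (M C t) + + (M C suc t)) * (l * l ^ t)
    ≡⟨ distrib l (+ (M C t)) (+ (M C suc t)) (l ^ t) ⟩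
  l * (+ (M C t) * l ^ t) + + (M C suc t) * (l * l ^ t) ∎
  where
  distrib : ∀ (l u v p : ℤ) → (u + v) * (l * p) ≡ l * (u * p) + v * (l * p)
  distrib = solve-∀

horner-binomialTerms-suc : ∀ M l r y →
  horner (binomialTerms (suc M) l) (suc r) y ≡ (y + l) * horner (binomialTerms M l) r y + binomialTerms M l (suc r)
horner-binomialTerms-suc M l zero y = begin
  horner (binomialTerms (suc M) l) 1 y
    ≡⟨ horner-suc (binomialTerms (suc M) l) 0 y ⟩
  y * horner (binomialTerms (suc M) l) 0 y + binomialTerms (suc M) l 1
    ≡⟨ cong₂ (λ u v → y * u + v) (horner-zero (binomialTerms (suc M) l) y) (binomialTerms-pascal M l 0) ⟩
  y * 1ℤ + (l * 1ℤ + binomialTerms M l 1)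
    ≡⟨ factor y l (binomialTerms M l 1) ⟩
  (y + l) * 1ℤ + binomialTerms M l 1
    ≡⟨ cong (λ t → (y + l) * t + binomialTerms M l 1) (horner-zero (binomialTerms M l) y) ⟨
  (y + l) * horner (binomialTerms M l) 0 y + binomialTerms M l 1 ∎
  where
  factor : ∀ (y l b : ℤ) → y * 1ℤ + (l * 1ℤ + b) ≡ (y + l) * 1ℤ + b
  factor = solve-∀
horner-binomialTerms-suc M l (suc r) y = begin
  horner (binomialTerms (suc M) l) (suc (suc r)) y
    ≡⟨ horner-suc (binomialTerms (suc M) l) (suc r) y ⟩
  y * horner (binomialTerms (suc M) l) (suc r) y + binomialTerms (suc M) l (suc (suc r))
    ≡⟨ cong₂ (λ u v → y * u + v) (horner-binomialTerms-suc M l r y) (binomialTerms-pascal M l (suc r)) ⟩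
  y * ((y + l) * h + b₁) + (l * b₁ + b₂)   ≡⟨ factor y l h b₁ b₂ ⟩
  (y + l) * (y * h + b₁) + b₂              ≡⟨ cong (λ t → (y + l) * t + b₂) (horner-suc (binomialTerms M l) r y) ⟨
  (y + l) * horner (binomialTerms M l) (suc r) y + b₂ ∎
  where
  h = horner (binomialTerms M l) r y
  b₁ = binomialTerms M l (suc r)
  b₂ = binomialTerms M l (suc (suc r))
  factor : ∀ (y l h b₁ b₂ : ℤ) → y * ((y + l) * h + b₁) + (l * b₁ + b₂) ≡ (y + l) * (y * h + b₁) + b₂
  factor = solve-∀

binomial-theorem : ∀ M l y → horner (binomialTerms M l) M y ≡ (y + l) ^ M
binomial-theorem zero    l y = refl
binomial-theorem (suc M) l y = begin
  horner (binomialTerms (suc M) l) (suc M) y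
    ≡⟨ horner-binomialTerms-suc M l M y ⟩
  (y + l) * horner (binomialTerms M l) M y + + (M C suc M) * l ^ suc M
    ≡⟨ cong₂ (λ u m → (y + l) * u + + m * l ^ suc M) (binomial-theorem M l y) (k>n⇒nCk≡0 (ℕP.n<1+n M)) ⟩
  (y + l) * (y + l) ^ M + 0ℤ * l ^ suc M
    ≡⟨ cong (_+_ ((y + l) * (y + l) ^ M)) (ℤP.*-zeroˡ (l ^ suc M)) ⟩
  (y + l) * (y + l) ^ M + 0ℤ
    ≡⟨ ℤP.+-identityʳ _ ⟩
  (y + l) ^ suc M ∎

-- Coefficients of the power series (1 - l T)^-(q+1).
negativeBinomialTerms : ℕ → ℤ → ℕ → ℤ
negativeBinomialTerms q l t = + ((q ℕ.+ t) C t) * l ^ t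

horner-binomialTerms-shift : ∀ q r l y →
  horner (binomialTerms (suc (q ℕ.+ r)) l) r y ≡ horner (negativeBinomialTerms q l) r (y + l)
horner-binomialTerms-shift q zero    l y = refl
horner-binomialTerms-shift q (suc r) l y = begin
  horner (binomialTerms (suc (q ℕ.+ suc r)) l) (suc r) y
    ≡⟨ cong (λ M → horner (binomialTerms (suc M) l) (suc r) y) (ℕP.+-suc q r) ⟩
  horner (binomialTerms (suc (suc (q ℕ.+ r))) l) (suc r) y
    ≡⟨ horner-binomialTerms-suc (suc (q ℕ.+ r)) l r y ⟩
  (y + l) * horner (binomialTerms (suc (q ℕ.+ r)) l) r y + binomialTerms (suc (q ℕ.+ r)) l (suc r)
    ≡⟨ cong₂ (λ u M → (y + l) * u + binomialTerms M l (suc r))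
             (horner-binomialTerms-shift q r l y) (sym (ℕP.+-suc q r)) ⟩
  (y + l) * horner (negativeBinomialTerms q l) r (y + l) + negativeBinomialTerms q l (suc r)
    ≡⟨ horner-suc (negativeBinomialTerms q l) r (y + l) ⟨
  horner (negativeBinomialTerms q l) (suc r) (y + l) ∎

-- The coefficients of F(x + l y, y) in terms of those of F.
shiftedCoefficients : ℕ → (ℕ → ℤ) → ℤ → ℕ → ℤ
shiftedCoefficients n a l j = sumBelow (suc j) (λ i → a i * binomialTerms (n ∸ i) l (j ∸ i))

horner-shift : ∀ n a l z → horner a n (z + l) ≡ horner (shiftedCoefficients n a l) n z
horner-shift n a l z = begin
  horner a n (z + l)                                 ≡⟨ horner-sumBelow a n (z + l) ⟩
  sumBelow (suc n) (λ i → a i * (z + l) ^ (n ∸ i))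
    ≡⟨ sumBelow-cong (suc n) (λ i _ → cong (a i *_) (binomial-theorem (n ∸ i) l z)) ⟨
  sumBelow (suc n) (λ i → a i * horner (binomialTerms (n ∸ i) l) (n ∸ i) z)
    ≡⟨ horner-convolution a (λ i → binomialTerms (n ∸ i) l) n z ⟨
  horner (shiftedCoefficients n a l) n z             ∎

shiftedForm-coefficients : ∀ n a b l → (∀ x y → evalForm n a (x + l * y) y ≡ evalForm n b x y) →
  ∀ j → j ℕ.≤ n → b j ≡ shiftedCoefficients n a l j
shiftedForm-coefficients n a b l shift = horner-injective n b (shiftedCoefficients n a l) (λ z → begin
  horner b n z                        ≡⟨ evalForm-at-1 n b z ⟨
  evalForm n b z 1ℤ                   ≡⟨ shift z 1ℤ ⟨
  evalForm n a (z + l * 1ℤ) 1ℤ        ≡⟨ evalForm-at-1 n a (z + l * 1ℤ) ⟩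
  horner a n (z + l * 1ℤ)             ≡⟨ cong (λ w → horner a n (z + w)) (ℤP.*-identityʳ l) ⟩
  horner a n (z + l)                  ≡⟨ horner-shift n a l z ⟩
  horner (shiftedCoefficients n a l) n z ∎)

1≤k≤n∸1⇒k<n : ∀ {k n} → 1 ℕ.≤ k → k ℕ.≤ n ∸ 1 → k ℕ.< n
1≤k≤n∸1⇒k<n {n = zero}  (s≤s _) ()
1≤k≤n∸1⇒k<n {n = suc n} _       k≤n = s≤s k≤n

n∸i≡1+[n∸[1+k]+[k∸i]] : ∀ n k i → i ℕ.≤ k → k ℕ.< n → n ∸ i ≡ suc (n ∸ suc k ℕ.+ (k ∸ i))
n∸i≡1+[n∸[1+k]+[k∸i]] n       k       zero    z≤n       k<n       =
  sym (trans (sym (ℕP.+-suc (n ∸ suc k) k)) (ℕP.m∸n+n≡m k<n))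
n∸i≡1+[n∸[1+k]+[k∸i]] (suc n) (suc k) (suc i) (s≤s i≤k) (s≤s k<n) = n∸i≡1+[n∸[1+k]+[k∸i]] n k i i≤k k<n

[n∸k+j]∸1≡n∸[1+k]+j : ∀ n k j → k ℕ.< n → n ∸ k ℕ.+ j ∸ 1 ≡ n ∸ suc k ℕ.+ j
[n∸k+j]∸1≡n∸[1+k]+j n k j k<n = begin
  n ∸ k ℕ.+ j ∸ 1     ≡⟨ ℕP.+-∸-comm j (ℕP.m<n⇒0<n∸m k<n) ⟩
  n ∸ k ∸ 1 ℕ.+ j     ≡⟨ cong (ℕ._+ j) (ℕP.∸-+-assoc n k 1) ⟩
  n ∸ (k ℕ.+ 1) ℕ.+ j ≡⟨ cong (λ m → n ∸ m ℕ.+ j) (ℕP.+-comm k 1) ⟩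
  n ∸ suc k ℕ.+ j     ∎

mainTheorem11 : (n : ℕ) (a b : ℕ → ℤ) (l : ℤ) →
    IrreducibleForm n a →
    (∀ x y → evalForm n a (x + l * y) y ≡ evalForm n b x y) →
    ∀ k → 1 ℕ.≤ k → k ℕ.≤ n ∸ 1 →
    ∀ x → sPoly b k (x - l) + b k
    ≡ sumBelow k (λ j → + ((n ∸ k ℕ.+ j ∸ 1) C j) * (sPoly a (k ∸ j) x + a (k ∸ j)) * (l ^ j))
    + + ((n ∸ 1) C k) * (l ^ k) * a 0
mainTheorem11 n a b l _ shift k 1≤k k≤n∸1 x = begin
  horner b k (x - l)
    ≡⟨ horner-cong k (x - l) (λ j j≤k → shiftedForm-coefficients n a b l shift j (ℕP.≤-trans j≤k (ℕP.<⇒≤ k<n))) ⟩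
  horner (shiftedCoefficients n a l) k (x - l)
    ≡⟨ horner-convolution a (λ i → binomialTerms (n ∸ i) l) k (x - l) ⟩
  sumBelow (suc k) (λ i → a i * horner (binomialTerms (n ∸ i) l) (k ∸ i) (x - l))
    ≡⟨ sumBelow-cong (suc k) (λ i i<1+k → cong (a i *_) (truncation i (ℕP.≤-pred i<1+k))) ⟩
  sumBelow (suc k) (λ i → a i * horner (negativeBinomialTerms p l) (k ∸ i) x)
    ≡⟨ sumBelow-horner-swap a (negativeBinomialTerms p l) k x ⟩
  sumBelow k (λ j → negativeBinomialTerms p l j * horner a (k ∸ j) x)
    + negativeBinomialTerms p l k * horner a (k ∸ k) x
    ≡⟨ cong₂ _+_ (sumBelow-cong k (λ j _ → term j)) lastTerm ⟩
  sumBelow k (λ j → + ((n ∸ k ℕ.+ j ∸ 1) C j) * horner a (k ∸ j) x * l ^ j) + + ((n ∸ 1) C k) * l ^ k * a 0 ∎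
  where
  k<n = 1≤k≤n∸1⇒k<n 1≤k k≤n∸1
  p = n ∸ suc k
  x-l+l≡x : ∀ (x l : ℤ) → x - l + l ≡ x
  x-l+l≡x = solve-∀
  truncation : ∀ i → i ℕ.≤ k →
    horner (binomialTerms (n ∸ i) l) (k ∸ i) (x - l) ≡ horner (negativeBinomialTerms p l) (k ∸ i) x
  truncation i i≤k = begin
    horner (binomialTerms (n ∸ i) l) (k ∸ i) (x - l)
      ≡⟨ cong (λ M → horner (binomialTerms M l) (k ∸ i) (x - l)) (n∸i≡1+[n∸[1+k]+[k∸i]] n k i i≤k k<n) ⟩
    horner (binomialTerms (suc (p ℕ.+ (k ∸ i))) l) (k ∸ i) (x - l)
      ≡⟨ horner-binomialTerms-shift p (k ∸ i) l (x - l) ⟩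
    horner (negativeBinomialTerms p l) (k ∸ i) (x - l + l)
      ≡⟨ cong (horner (negativeBinomialTerms p l) (k ∸ i)) (x-l+l≡x x l) ⟩
    horner (negativeBinomialTerms p l) (k ∸ i) x ∎
  term : ∀ j → negativeBinomialTerms p l j * horner a (k ∸ j) x
               ≡ + ((n ∸ k ℕ.+ j ∸ 1) C j) * horner a (k ∸ j) x * l ^ j
  term j = trans (xy∙z≈xz∙y (+ ((p ℕ.+ j) C j)) (l ^ j) (horner a (k ∸ j) x))
                 (cong (λ m → + (m C j) * horner a (k ∸ j) x * l ^ j) (sym ([n∸k+j]∸1≡n∸[1+k]+j n k j k<n)))
  lastTerm : negativeBinomialTerms p l k * horner a (k ∸ k) x ≡ + ((n ∸ 1) C k) * l ^ k * a 0
  lastTerm = cong₂ (λ m h → + (m C k) * l ^ k * h)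
                   (sym (cong (_∸ 1) (n∸i≡1+[n∸[1+k]+[k∸i]] n k 0 z≤n k<n)))
                   (trans (cong (λ m → horner a m x) (ℕP.n∸n≡0 k)) (horner-zero a x))
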